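{- For every Turing degree $\boldsymbol{d}$, there exist equivalence relations $E$ and $F$ on $\omega$ such that $E$ is finitarily reducible to $F$ via a computable function, but there is no $\boldsymbol{d}$-computable reduction from $E$ to $F$.
   Context: A reduction from $E$ to $F$ is a function $g:\omega\to\omega$ with $x\,E\,y\iff g(x)\,F\,g(y)$ for all $x,y$; it is $\boldsymbol{d}$-computable if computable from a set of degree $\boldsymbol{d}$. An $n$-ary reduction from $E$ to $F$ is a computable total $f:\omega\times\omega^n\to\omega$ such that for all $\vec x\in\omega^n$, with $y_i=f(i,\vec x)$, $x_i\,E\,x_j\iff y_i\,F\,y_j$ for all $i<j<n$; $E$ is finitarily reducible to $F$ if there is one computable $f(n,i,\vec x)$ which for each $n$ is an $n$-ary reduction. -}

module Defs where

open import Data.Nat using (ℕ; zero; suc; _+_; _*_; ⌊_/2⌋)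
open import Data.Bool using (Bool; true; false)
open import Data.Fin using (Fin; toℕ; _<_)
open import Data.Vec using (Vec; []; _∷_; lookup)
open import Data.Product using (Σ; _×_; _,_; ∃)
open import Level using (0ℓ)
open import Relation.Binary using (Rel; IsEquivalence)
open import Relation.Nullary using (¬_)
open import Function.Bundles using (_⇔_)

Oracle : Set
Oracle = ℕ → Bool

χ : Bool → ℕ
χ true  = 1
χ false = 0

-- the empty oracle (plain computability)
∅ : Oracle
∅ _ = false

-- Codes of partial recursive functions of arity k, relative to an oracle
-- (Kleene's μ-recursive functions plus the oracle's characteristic function).

data PR : ℕ → Set where
  zer    : ∀ {k} → PR k
  succ   : PR 1
  proj   : ∀ {k} → Fin k → PR k
  orc    : PR 1
  comp   : ∀ {m k} → PR m → Vec (PR k) m → PR k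
  prim   : ∀ {k} → PR k → PR (suc (suc k)) → PR (suc k)
  mu     : ∀ {k} → PR (suc k) → PR k

-- Big-step semantics:  A ⊢ c [ xs ]⇓ v  means  Φ_c^A(xs) converges to v.
mutual
  data _⊢_[_]⇓_ (A : Oracle) : ∀ {k} → PR k → Vec ℕ k → ℕ → Set where
    ev-zer  : ∀ {k} {xs : Vec ℕ k} → A ⊢ zer [ xs ]⇓ 0
    ev-succ : ∀ {x} → A ⊢ succ [ x ∷ [] ]⇓ suc x
    ev-proj : ∀ {k} {i : Fin k} {xs} → A ⊢ proj i [ xs ]⇓ lookup xs i
    ev-orc  : ∀ {x} → A ⊢ orc [ x ∷ [] ]⇓ χ (A x)
    ev-comp : ∀ {m k} {f : PR m} {gs : Vec (PR k) m} {xs ys v} →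
              A ⊢ gs [ xs ]⇓* ys → A ⊢ f [ ys ]⇓ v → A ⊢ comp f gs [ xs ]⇓ v
    ev-prim0 : ∀ {k} {g : PR k} {h} {xs v} →
               A ⊢ g [ xs ]⇓ v → A ⊢ prim g h [ 0 ∷ xs ]⇓ v
    ev-primS : ∀ {k} {g : PR k} {h} {n xs r v} →
               A ⊢ prim g h [ n ∷ xs ]⇓ r → A ⊢ h [ n ∷ r ∷ xs ]⇓ v →
               A ⊢ prim g h [ suc n ∷ xs ]⇓ v
    ev-mu   : ∀ {k} {f : PR (suc k)} {xs y} →
              A ⊢ f [ y ∷ xs ]⇓ 0 → Below A f xs y → A ⊢ mu f [ xs ]⇓ y

  data Below (A : Oracle) {k} (f : PR (suc k)) (xs : Vec ℕ k) : ℕ → Set where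
    below0 : Below A f xs 0
    belowS : ∀ {y v} → Below A f xs y → A ⊢ f [ y ∷ xs ]⇓ suc v → Below A f xs (suc y)

  data _⊢_[_]⇓*_ (A : Oracle) {k} : ∀ {m} → Vec (PR k) m → Vec ℕ k → Vec ℕ m → Set where
    ev[]  : ∀ {xs} → A ⊢ [] [ xs ]⇓* []
    ev∷   : ∀ {m} {g} {gs : Vec (PR k) m} {xs v vs} →
            A ⊢ g [ xs ]⇓ v → A ⊢ gs [ xs ]⇓* vs → A ⊢ (g ∷ gs) [ xs ]⇓* (v ∷ vs)

-- Coding of finite tuples by natural numbers (Cantor pairing).

pair : ℕ → ℕ → ℕ
pair x y = ⌊ (x + y) * suc (x + y) /2⌋ + y

code : ∀ {n} → Vec ℕ n → ℕ
code []       = 0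
code (x ∷ xs) = suc (pair x (code xs))

_-computable : Oracle → (ℕ → ℕ) → Set
(A -computable) g = Σ (PR 1) λ c → ∀ x → A ⊢ c [ x ∷ [] ]⇓ g x

IsReduction : Rel ℕ 0ℓ → Rel ℕ 0ℓ → (ℕ → ℕ) → Set
IsReduction E F g = ∀ x y → E x y ⇔ F (g x) (g y)

-- E is finitarily reducible to F: a single computable total f(n, i, x⃗)
-- (x⃗ ∈ ω^n passed via its code) that is an n-ary reduction for every n.
FinitarilyReducible : Rel ℕ 0ℓ → Rel ℕ 0ℓ → Set
FinitarilyReducible E F =
  Σ (PR 3) λ c → Σ ((n : ℕ) → ℕ → Vec ℕ n → ℕ) λ f →
    (∀ n i (xs : Vec ℕ n) → ∅ ⊢ c [ n ∷ i ∷ code xs ∷ [] ]⇓ f n i xs)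
    × (∀ n (xs : Vec ℕ n) (i j : Fin n) → i < j →
         E (lookup xs i) (lookup xs j) ⇔ F (f n (toℕ i) xs) (f n (toℕ j) xs))

-- For any equivalence relation E let Positional E relate the numbers
-- ⟨x⃗, i⟩ and ⟨x⃗, j⟩ coding two entries of one tuple x⃗ whenever x_i E x_j.
-- Then (n, i, x⃗) ↦ ⟨x⃗, i⟩ is a computable finitary reduction of E to Positional E,
-- and every Positional E class is finite (classically, so under a double negation).
-- For E we collapse 0 together with the "diagonal" numbers into one class:
-- x = ⟨c, L⟩ is diagonal when Φ_c^D(x) has no value in the finite list L.
-- If a D-computable g (program c) reduced E to a relation F with finite classes,
-- let L list the F-class of g 0 and x = ⟨c, L⟩; then g x ∈ L iff x E 0 iff x is
-- diagonal iff g x ∉ L, which is absurd.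

module Submission where

open import Defs
open import Data.Nat using (ℕ; zero; suc; _+_; _*_; ⌊_/2⌋; _<_; _≤_; s≤s; z≤n)
open import Data.Nat.Properties
  using (suc-injective; +-comm; +-mono-≤; +-monoʳ-≤; m≤n+m; m≤m+n; n≡⌊n+n/2⌋; <-irrefl; <-cmp;
         +-cancelˡ-≡; +-cancelʳ-≡; m≤n⇒m<n∨m≡n; module ≤-Reasoning)
open import Data.Nat.Tactic.RingSolver using (solve-∀)
open import Data.Fin using (Fin; toℕ) renaming (zero to #0; suc to 1+)
open import Data.Fin.Properties using (toℕ-injective)
open import Data.Vec using (Vec; []; _∷_; lookup; fromList; toList)
open import Data.Vec.Properties using (toList∘fromList)
open import Data.List using (List; []; _∷_; map; filter; allFin)
open import Data.List.Properties using (∷-injective)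
open import Data.List.Membership.Propositional using (_∈_)
open import Data.List.Membership.Propositional.Properties
  using (∈-map⁺; ∈-map⁻; ∈-filter⁺; ∈-filter⁻; ∈-allFin)
open import Data.List.Relation.Unary.Any using (here; there)
open import Data.Maybe as Maybe using (Maybe; just; nothing; zipWith)
open import Data.Maybe.Properties using (just-injective)
open import Data.Product using (Σ; _×_; _,_; proj₂)
open import Data.Sum using (_⊎_; inj₁; inj₂)
open import Data.Empty using (⊥; ⊥-elim)
open import Effect.Monad using (RawMonad)
open import Function using (_∘_)
open import Function.Bundles using (_⇔_; mk⇔; Equivalence)
open import Function.Construct.Composition using (_⇔-∘_)
open import Level using (0ℓ)
open import Relation.Binary using (Rel; IsEquivalence; tri<; tri≈; tri>)
open import Relation.Binary.PropositionalEquality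
open import Relation.Nullary using (¬_; Dec; yes; no; ¬¬-excluded-middle)
open import Relation.Nullary.Negation using (¬¬-Monad)
open import Relation.Unary using (Decidable)

open RawMonad (¬¬-Monad {0ℓ}) using (pure; _>>=_)

tri : ℕ → ℕ
tri zero    = 0
tri (suc s) = suc (s + tri s)

tri-double : ∀ s → s * suc s ≡ tri s + tri s
tri-double zero    = refl
tri-double (suc s) = begin
  suc s * suc (suc s)               ≡⟨ expand s ⟩
  (suc s + suc s) + s * suc s       ≡⟨ cong (suc s + suc s +_) (tri-double s) ⟩
  (suc s + suc s) + (tri s + tri s) ≡⟨ regroup (suc s) (tri s) ⟩
  tri (suc s) + tri (suc s)         ∎
  where
  open ≡-Reasoning
  expand : ∀ s → suc s * suc (suc s) ≡ (suc s + suc s) + s * suc s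
  expand = solve-∀
  regroup : ∀ a b → (a + a) + (b + b) ≡ (a + b) + (a + b)
  regroup = solve-∀

pair-diagonal : ∀ x y → pair x y ≡ tri (x + y) + y
pair-diagonal x y = cong (_+ y) (begin
  ⌊ s * suc s /2⌋       ≡⟨ cong ⌊_/2⌋ (tri-double s) ⟩
  ⌊ tri s + tri s /2⌋   ≡⟨ sym (n≡⌊n+n/2⌋ (tri s)) ⟩
  tri s                 ∎)
  where
  open ≡-Reasoning
  s = x + y

tri-mono : ∀ {s t} → s ≤ t → tri s ≤ tri t
tri-mono z≤n       = z≤n
tri-mono (s≤s s≤t) = s≤s (+-mono-≤ s≤t (tri-mono s≤t))

diagonal-bounded : ∀ s {y} → y ≤ s → tri s + y < tri (suc s)
diagonal-bounded s {y} y≤s = s≤s (begin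
  tri s + y   ≤⟨ +-monoʳ-≤ (tri s) y≤s ⟩
  tri s + s   ≡⟨ +-comm (tri s) s ⟩
  s + tri s   ∎)
  where open ≤-Reasoning

pair-<-diagonal : ∀ x y x′ y′ → x + y < x′ + y′ → pair x y < pair x′ y′
pair-<-diagonal x y x′ y′ lt = begin-strict
  pair x y             ≡⟨ pair-diagonal x y ⟩
  tri (x + y) + y      <⟨ diagonal-bounded (x + y) (m≤n+m y x) ⟩
  tri (suc (x + y))    ≤⟨ tri-mono lt ⟩
  tri (x′ + y′)        ≤⟨ m≤m+n _ y′ ⟩
  tri (x′ + y′) + y′   ≡⟨ pair-diagonal x′ y′ ⟨
  pair x′ y′           ∎
  where open ≤-Reasoning

-- Cantor pairing is injective: equal codes lie on the same diagonal, at the same place.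
pair-injective : ∀ x y x′ y′ → pair x y ≡ pair x′ y′ → x ≡ x′ × y ≡ y′
pair-injective x y x′ y′ eq with <-cmp (x + y) (x′ + y′)
... | tri< lt _ _ = ⊥-elim (<-irrefl eq (pair-<-diagonal x y x′ y′ lt))
... | tri> _ _ gt = ⊥-elim (<-irrefl (sym eq) (pair-<-diagonal x′ y′ x y gt))
... | tri≈ _ same _ = x≡x′ , y≡y′
  where
  y≡y′ : y ≡ y′
  y≡y′ = +-cancelˡ-≡ (tri (x + y)) y y′ (begin
    tri (x + y) + y     ≡⟨ pair-diagonal x y ⟨
    pair x y            ≡⟨ eq ⟩
    pair x′ y′          ≡⟨ pair-diagonal x′ y′ ⟩
    tri (x′ + y′) + y′  ≡⟨ cong (λ s → tri s + y′) same ⟨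
    tri (x + y) + y′    ∎)
    where open ≡-Reasoning
  x≡x′ : x ≡ x′
  x≡x′ = +-cancelʳ-≡ y x x′ (trans same (cong (x′ +_) (sym y≡y′)))

code-injective : ∀ {m n} (xs : Vec ℕ m) (ys : Vec ℕ n) →
                 code xs ≡ code ys → _≡_ {A = Σ ℕ (Vec ℕ)} (m , xs) (n , ys)
code-injective []       []       _  = refl
code-injective (x ∷ xs) (y ∷ ys) eq with pair-injective x (code xs) y (code ys) (suc-injective eq)
... | refl , same-tail with code-injective xs ys same-tail
... | refl = refl

data Tree : Set where
  node : (tag payload : ℕ) → List Tree → Tree

mutual
  toTree : ∀ {k} → PR k → Tree
  toTree zer             = node 0 0 []
  toTree succ            = node 1 0 []
  toTree (proj i)        = node 2 (toℕ i) []
  toTree orc             = node 3 0 []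
  toTree (comp {m} f gs) = node 4 m (toTree f ∷ toTrees gs)
  toTree (prim g h)      = node 5 0 (toTree g ∷ toTree h ∷ [])
  toTree (mu f)          = node 6 0 (toTree f ∷ [])

  toTrees : ∀ {k m} → Vec (PR k) m → List Tree
  toTrees []       = []
  toTrees (g ∷ gs) = toTree g ∷ toTrees gs

toFin : (k : ℕ) → ℕ → Maybe (Fin k)
toFin zero    _       = nothing
toFin (suc k) zero    = just #0
toFin (suc k) (suc i) = Maybe.map 1+ (toFin k i)

unary : (k : ℕ) → PR 1 → Maybe (PR k)
unary 1 c = just c
unary _ _ = nothing

mutual
  fromTree : (k : ℕ) → Tree → Maybe (PR k)
  fromTree k       (node 0 _ [])                = just zer
  fromTree k       (node 1 _ [])                = unary k succ
  fromTree k       (node 2 i [])                = Maybe.map proj (toFin k i)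
  fromTree k       (node 3 _ [])                = unary k orc
  fromTree k       (node 4 m (f ∷ gs))          = zipWith comp (fromTree m f) (fromTrees k m gs)
  fromTree k       (node 5 _ (g ∷ h ∷ []))      = primitiveRecursion k g h
  fromTree k       (node 6 _ (f ∷ []))          = Maybe.map mu (fromTree (suc k) f)
  fromTree _       _                            = nothing

  primitiveRecursion : (k : ℕ) → Tree → Tree → Maybe (PR k)
  primitiveRecursion zero    _ _ = nothing
  primitiveRecursion (suc k) g h = zipWith prim (fromTree k g) (fromTree (suc (suc k)) h)

  fromTrees : (k m : ℕ) → List Tree → Maybe (Vec (PR k) m)
  fromTrees k zero    []       = just []
  fromTrees k (suc m) (t ∷ ts) = zipWith _∷_ (fromTree k t) (fromTrees k m ts)
  fromTrees _ _       _        = nothing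

toFin-toℕ : ∀ {k} (i : Fin k) → toFin k (toℕ i) ≡ just i
toFin-toℕ #0     = refl
toFin-toℕ (1+ i) = cong (Maybe.map 1+) (toFin-toℕ i)

mutual
  fromTree-toTree : ∀ {k} (c : PR k) → fromTree k (toTree c) ≡ just c
  fromTree-toTree zer         = refl
  fromTree-toTree succ        = refl
  fromTree-toTree (proj i)    = cong (Maybe.map proj) (toFin-toℕ i)
  fromTree-toTree orc         = refl
  fromTree-toTree (comp f gs) = cong₂ (zipWith comp) (fromTree-toTree f) (fromTrees-toTrees gs)
  fromTree-toTree (prim g h)  = cong₂ (zipWith prim) (fromTree-toTree g) (fromTree-toTree h)
  fromTree-toTree (mu f)      = cong (Maybe.map mu) (fromTree-toTree f)

  fromTrees-toTrees : ∀ {k m} (gs : Vec (PR k) m) → fromTrees k m (toTrees gs) ≡ just gs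
  fromTrees-toTrees []       = refl
  fromTrees-toTrees (g ∷ gs) = cong₂ (zipWith _∷_) (fromTree-toTree g) (fromTrees-toTrees gs)

toTree-injective : ∀ {k} {c c′ : PR k} → toTree c ≡ toTree c′ → c ≡ c′
toTree-injective {k} {c} {c′} eq = just-injective (begin
  just c                ≡⟨ fromTree-toTree c ⟨
  fromTree k (toTree c)  ≡⟨ cong (fromTree k) eq ⟩
  fromTree k (toTree c′) ≡⟨ fromTree-toTree c′ ⟩
  just c′               ∎)
  where open ≡-Reasoning

mutual
  treeCode : Tree → ℕ
  treeCode (node t p ts) = pair t (pair p (treesCode ts))

  treesCode : List Tree → ℕ
  treesCode []       = 0
  treesCode (t ∷ ts) = suc (pair (treeCode t) (treesCode ts))

mutual
  treeCode-injective : ∀ {t t′} → treeCode t ≡ treeCode t′ → t ≡ t′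
  treeCode-injective {node t p ts} {node t′ p′ ts′} eq
    with pair-injective t (pair p (treesCode ts)) t′ (pair p′ (treesCode ts′)) eq
  ... | refl , rest with pair-injective p (treesCode ts) p′ (treesCode ts′) rest
  ... | refl , same-children = cong (node t p) (treesCode-injective same-children)

  treesCode-injective : ∀ {ts ts′} → treesCode ts ≡ treesCode ts′ → ts ≡ ts′
  treesCode-injective {[]}     {[]}       _  = refl
  treesCode-injective {t ∷ ts} {t′ ∷ ts′} eq
    with pair-injective (treeCode t) (treesCode ts) (treeCode t′) (treesCode ts′) (suc-injective eq)
  ... | same-head , same-tail = cong₂ _∷_ (treeCode-injective same-head) (treesCode-injective same-tail)

programCode : ∀ {k} → PR k → ℕ
programCode = treeCode ∘ toTree

programCode-injective : ∀ {k} {c c′ : PR k} → programCode c ≡ programCode c′ → c ≡ c′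
programCode-injective = toTree-injective ∘ treeCode-injective

diagonalIndex : PR 1 → List ℕ → ℕ
diagonalIndex c L = code (programCode c ∷ fromList L)

diagonalIndex-injective : ∀ c L c′ L′ →
                          diagonalIndex c L ≡ diagonalIndex c′ L′ → c ≡ c′ × L ≡ L′
diagonalIndex-injective c L c′ L′ eq
  with ∷-injective (cong (toList ∘ proj₂)
         (code-injective (programCode c ∷ fromList L) (programCode c′ ∷ fromList L′) eq))
... | same-program , same-list =
  programCode-injective same-program ,
  trans (sym (toList∘fromList L)) (trans same-list (toList∘fromList L′))

position : ∀ {n} → Vec ℕ n → Fin n → ℕ
position xs i = pair (code xs) (toℕ i)

position-injective : ∀ {m n} (xs : Vec ℕ m) (i : Fin m) (ys : Vec ℕ n) (j : Fin n) →
                     position xs i ≡ position ys j →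
                     _≡_ {A = Σ ℕ (Vec ℕ)} (m , xs) (n , ys) × toℕ i ≡ toℕ j
position-injective xs i ys j eq with pair-injective (code xs) (toℕ i) (code ys) (toℕ j) eq
... | same-code , same-index = code-injective xs ys same-code , same-index

-- Evaluation is deterministic: a program converges to at most one value.
-- For minimisation, a zero found below the chosen witness contradicts Below.
mutual
  evaluation-deterministic : ∀ {A k} {c : PR k} {xs v w} →
                             A ⊢ c [ xs ]⇓ v → A ⊢ c [ xs ]⇓ w → v ≡ w
  evaluation-deterministic ev-zer  ev-zer  = refl
  evaluation-deterministic ev-succ ev-succ = refl
  evaluation-deterministic ev-proj ev-proj = refl
  evaluation-deterministic ev-orc  ev-orc  = refl
  evaluation-deterministic (ev-comp args out) (ev-comp args′ out′)
    with evaluations-deterministic args args′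
  ... | refl = evaluation-deterministic out out′
  evaluation-deterministic (ev-prim0 base) (ev-prim0 base′) = evaluation-deterministic base base′
  evaluation-deterministic (ev-primS rec step) (ev-primS rec′ step′)
    with evaluation-deterministic rec rec′
  ... | refl = evaluation-deterministic step step′
  evaluation-deterministic (ev-mu {y = y} zero-at below) (ev-mu {y = y′} zero-at′ below′)
    with <-cmp y y′
  ... | tri< y<y′ _ _ = ⊥-elim (no-zero-below below′ zero-at y<y′)
  ... | tri≈ _ y≡y′ _ = y≡y′
  ... | tri> _ _ y′<y = ⊥-elim (no-zero-below below zero-at′ y′<y)

  no-zero-below : ∀ {A k} {f : PR (suc k)} {xs y z} →
                  Below A f xs y → A ⊢ f [ z ∷ xs ]⇓ 0 → z < y → ⊥
  no-zero-below (belowS below nonzero) zero-at (s≤s z≤y) with m≤n⇒m<n∨m≡n z≤y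
  ... | inj₁ z<y  = no-zero-below below zero-at z<y
  ... | inj₂ refl with evaluation-deterministic nonzero zero-at
  ... | ()

  evaluations-deterministic : ∀ {A k m} {gs : Vec (PR k) m} {xs ys ys′} →
                              A ⊢ gs [ xs ]⇓* ys → A ⊢ gs [ xs ]⇓* ys′ → ys ≡ ys′
  evaluations-deterministic ev[]         ev[]           = refl
  evaluations-deterministic (ev∷ g⇓ gs⇓) (ev∷ g⇓′ gs⇓′) =
    cong₂ _∷_ (evaluation-deterministic g⇓ g⇓′) (evaluations-deterministic gs⇓ gs⇓′)

plusProgram : PR 2
plusProgram = prim (proj #0) (comp succ (proj (1+ #0) ∷ []))

plusProgram-computes : ∀ {A} a b → A ⊢ plusProgram [ a ∷ b ∷ [] ]⇓ (a + b)
plusProgram-computes zero    b = ev-prim0 ev-proj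
plusProgram-computes (suc a) b = ev-primS (plusProgram-computes a b) (ev-comp (ev∷ ev-proj ev[]) ev-succ)

triProgram : PR 1
triProgram = prim zer (comp succ (comp plusProgram (proj #0 ∷ proj (1+ #0) ∷ []) ∷ []))

triProgram-computes : ∀ {A} s → A ⊢ triProgram [ s ∷ [] ]⇓ tri s
triProgram-computes zero    = ev-prim0 ev-zer
triProgram-computes (suc s) = ev-primS (triProgram-computes s)
  (ev-comp (ev∷ (ev-comp (ev∷ ev-proj (ev∷ ev-proj ev[])) (plusProgram-computes s (tri s))) ev[]) ev-succ)

pairProgram : PR 3
pairProgram = comp plusProgram
  (comp triProgram (comp plusProgram (proj (1+ (1+ #0)) ∷ proj (1+ #0) ∷ []) ∷ []) ∷ proj (1+ #0) ∷ [])

pairProgram-computes : ∀ {A} n i m → A ⊢ pairProgram [ n ∷ i ∷ m ∷ [] ]⇓ pair m i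
pairProgram-computes {A} n i m = subst (A ⊢ pairProgram [ n ∷ i ∷ m ∷ [] ]⇓_) (sym (pair-diagonal m i))
  (ev-comp (ev∷ (ev-comp (ev∷ sum⇓ ev[]) (triProgram-computes (m + i))) (ev∷ ev-proj ev[]))
           (plusProgram-computes (tri (m + i)) i))
  where
  sum⇓ : A ⊢ comp plusProgram (proj (1+ (1+ #0)) ∷ proj (1+ #0) ∷ []) [ n ∷ i ∷ m ∷ [] ]⇓ (m + i)
  sum⇓ = ev-comp (ev∷ ev-proj (ev∷ ev-proj ev[])) (plusProgram-computes m i)

-- Classically every predicate on a finite set is decidable; constructively
-- this holds under a double negation, which suffices for proving negations.
¬¬-decidable-on-Fin : ∀ {n} (P : Fin n → Set) → ¬ ¬ Decidable P
¬¬-decidable-on-Fin {zero}  P = pure λ ()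
¬¬-decidable-on-Fin {suc n} P = do
  P0? ← ¬¬-excluded-middle
  P+? ← ¬¬-decidable-on-Fin (P ∘ 1+)
  pure λ { #0 → P0? ; (1+ j) → P+? j }

FiniteClass : Rel ℕ 0ℓ → ℕ → Set
FiniteClass R a = Σ (List ℕ) λ L → ∀ v → R a v ⇔ v ∈ L

Collapse : ∀ {A : Set} → (A → Set) → Rel A 0ℓ
Collapse S x y = x ≡ y ⊎ (S x × S y)

collapse-isEquivalence : ∀ {A : Set} (S : A → Set) → IsEquivalence (Collapse S)
collapse-isEquivalence S = record { refl = inj₁ refl ; sym = symmetric ; trans = transitive }
  where
  symmetric : ∀ {x y} → Collapse S x y → Collapse S y x
  symmetric (inj₁ x≡y)       = inj₁ (sym x≡y)
  symmetric (inj₂ (Sx , Sy)) = inj₂ (Sy , Sx)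
  transitive : ∀ {x y z} → Collapse S x y → Collapse S y z → Collapse S x z
  transitive (inj₁ refl)     y~z              = y~z
  transitive x~y             (inj₁ refl)      = x~y
  transitive (inj₂ (Sx , _)) (inj₂ (_ , Sz)) = inj₂ (Sx , Sz)

data Positional (E : Rel ℕ 0ℓ) : Rel ℕ 0ℓ where
  same    : ∀ {a} → Positional E a a
  entries : ∀ {n a b} (xs : Vec ℕ n) (i j : Fin n) → a ≡ position xs i → b ≡ position xs j →
            E (lookup xs i) (lookup xs j) → Positional E a b

module _ {E : Rel ℕ 0ℓ} (E-equivalence : IsEquivalence E) where
  open IsEquivalence E-equivalence using () renaming (refl to E-refl; sym to E-sym; trans to E-trans)

  positional-isEquivalence : IsEquivalence (Positional E)
  positional-isEquivalence = record { refl = same ; sym = symmetric ; trans = transitive }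
    where
    symmetric : ∀ {a b} → Positional E a b → Positional E b a
    symmetric same                     = same
    symmetric (entries xs i j a≡ b≡ e) = entries xs j i b≡ a≡ (E-sym e)
    -- the shared middle number determines the tuple and the middle index
    transitive : ∀ {a b c} → Positional E a b → Positional E b c → Positional E a c
    transitive same b~c = b~c
    transitive a~b same = a~b
    transitive (entries xs i j a≡ b≡ e) (entries ys j′ k b≡′ c≡ e′)
      with position-injective xs j ys j′ (trans (sym b≡) b≡′)
    ... | refl , same-index with toℕ-injective same-index
    ... | refl = entries xs i k a≡ c≡ (E-trans e e′)

  entries⁻ : ∀ {n a b} (xs : Vec ℕ n) (i j : Fin n) → Positional E a b →
             a ≡ position xs i → b ≡ position xs j → E (lookup xs i) (lookup xs j)
  entries⁻ xs i j same a≡ a≡′ with position-injective xs i xs j (trans (sym a≡) a≡′)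
  ... | refl , same-index with toℕ-injective same-index
  ... | refl = E-refl
  entries⁻ xs i j (entries ys i′ j′ a≡′ b≡′ e) a≡ b≡
    with position-injective xs i ys i′ (trans (sym a≡) a≡′)
       | position-injective xs j ys j′ (trans (sym b≡) b≡′)
  ... | refl , same-i | _ , same-j with toℕ-injective same-i | toℕ-injective same-j
  ... | refl | refl = e

  positional-finitary-reduction : FinitarilyReducible E (Positional E)
  positional-finitary-reduction =
    pairProgram , (λ n i xs → pair (code xs) i) ,
    (λ n i xs → pairProgram-computes n i (code xs)) ,
    λ n xs i j _ → mk⇔ (entries xs i j refl refl) (λ p → entries⁻ xs i j p refl refl)

IsPosition : ℕ → Set
IsPosition a = Σ ℕ λ n → Σ (Vec ℕ n) λ xs → Σ (Fin n) λ i → a ≡ position xs i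

module _ (E : Rel ℕ 0ℓ) where

  singleton-class : ∀ {a} → ¬ IsPosition a → FiniteClass (Positional E) a
  singleton-class {a} not-position = a ∷ [] , λ v → mk⇔ (member v) nonmember
    where
    member : ∀ v → Positional E a v → v ∈ a ∷ []
    member v same                      = here refl
    member v (entries xs i _ a≡ _ _)   = ⊥-elim (not-position (_ , xs , i , a≡))
    nonmember : ∀ {v} → v ∈ a ∷ [] → Positional E a v
    nonmember (here refl) = same

  position-class : ∀ {n} (xs : Vec ℕ n) (i : Fin n) →
                   Decidable (λ j → E (lookup xs i) (lookup xs j)) →
                   FiniteClass (Positional E) (position xs i)
  position-class {n} xs i E? = position xs i ∷ related , λ v → mk⇔ (member v) (nonmember v)
    where
    related : List ℕ
    related = map (position xs) (filter E? (allFin n))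
    member : ∀ v → Positional E (position xs i) v → v ∈ position xs i ∷ related
    member v same = here refl
    member v (entries ys i′ j a≡ v≡ e) with position-injective xs i ys i′ a≡
    ... | refl , same-index with toℕ-injective same-index
    ... | refl = there (subst (_∈ related) (sym v≡)
                   (∈-map⁺ (position xs) (∈-filter⁺ E? (∈-allFin j) e)))
    nonmember : ∀ v → v ∈ position xs i ∷ related → Positional E (position xs i) v
    nonmember v (here refl)  = same
    nonmember v (there v∈) with ∈-map⁻ (position xs) v∈
    ... | j , j∈ , v≡ = entries xs i j refl v≡ (proj₂ (∈-filter⁻ E? {xs = allFin n} j∈))

  positional-classes-finite : ∀ a → ¬ ¬ FiniteClass (Positional E) a
  positional-classes-finite a = ¬¬-excluded-middle >>= by-cases
    where
    by-cases : Dec (IsPosition a) → ¬ ¬ FiniteClass (Positional E) a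
    by-cases (no not-position) = pure (singleton-class not-position)
    by-cases (yes (n , xs , i , refl)) = do
      E? ← ¬¬-decidable-on-Fin (λ j → E (lookup xs i) (lookup xs j))
      pure (position-class xs i E?)

module Diagonalisation (D : Oracle) where

  Diagonal : ℕ → Set
  Diagonal x = Σ (PR 1) λ c → Σ (List ℕ) λ L →
               x ≡ diagonalIndex c L × ¬ Σ ℕ λ v → D ⊢ c [ x ∷ [] ]⇓ v × v ∈ L

  Special : ℕ → Set
  Special x = x ≡ 0 ⊎ Diagonal x

  E : Rel ℕ 0ℓ
  E = Collapse Special

  -- A D-computable g reducing E to F would send 0's class into the finite class L of g 0;
  -- the number x naming (program of g, L) is then special iff g x ∈ L iff it is not.
  no-reduction : (F : Rel ℕ 0ℓ) → (∀ a → ¬ ¬ FiniteClass F a) →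
                 ¬ Σ (ℕ → ℕ) λ g → (D -computable) g × IsReduction E F g
  no-reduction F finite (g , (c , c-computes) , g-reduces) = finite (g 0) refute
    where
    refute : FiniteClass F (g 0) → ⊥
    refute (L , class) = outside (Equivalence.to special⇔member (inj₂ diagonal))
      where
      x : ℕ
      x = diagonalIndex c L

      special⇔related : Special x ⇔ E 0 x
      special⇔related = mk⇔ (λ s → inj₂ (inj₁ refl , s)) λ { (inj₁ ()) ; (inj₂ (_ , s)) → s }

      special⇔member : Special x ⇔ (g x ∈ L)
      special⇔member = class (g x) ⇔-∘ (g-reduces 0 x ⇔-∘ special⇔related)

      -- if g x ∈ L then x is special, yet it can only be diagonal against (c, L) itself
      outside : ¬ g x ∈ L
      outside gx∈L with Equivalence.from special⇔member gx∈L
      ... | inj₂ (c′ , L′ , x≡ , avoids) with diagonalIndex-injective c L c′ L′ x≡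
      ... | refl , refl = avoids (g x , c-computes x , gx∈L)

      -- so Φ_c^D(x) = g x has no value in L, and x is diagonal
      diagonal : Diagonal x
      diagonal = c , L , refl , λ (v , c⇓v , v∈L) →
        outside (subst (_∈ L) (evaluation-deterministic c⇓v (c-computes x)) v∈L)

corollary3p8 : (D : Oracle) →
    Σ (Rel ℕ 0ℓ) λ E → Σ (Rel ℕ 0ℓ) λ F →
      IsEquivalence E × IsEquivalence F × FinitarilyReducible E F
      × (¬ Σ (ℕ → ℕ) λ g → (D -computable) g × IsReduction E F g)
corollary3p8 D =
  E , Positional E ,
  E-equivalence ,
  positional-isEquivalence E-equivalence ,
  positional-finitary-reduction E-equivalence ,
  no-reduction (Positional E) (positional-classes-finite E)
  where
  open Diagonalisation D
  E-equivalence : IsEquivalence E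
  E-equivalence = collapse-isEquivalence Special
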